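{- Let $\pi,\pi'$ be lex models and $\alpha,\beta$ outcomes. If $\alpha\succcurlyeq_\pi\beta$ and $\alpha\succcurlyeq_{\pi'}\beta$, then $\alpha\succcurlyeq_{\pi\circ\pi'}\beta$. If $\alpha\succcurlyeq_\pi\beta$ and $\alpha\succ_{\pi'}\beta$, then $\alpha\succ_{\pi\circ\pi'}\beta$ and $\alpha\succ_{\pi'\circ\pi}\beta$. If $\alpha\equiv_\pi\beta$, then $\alpha\succcurlyeq_{\pi'}\beta\iff\alpha\succcurlyeq_{\pi\circ\pi'}\beta$, and $\alpha\succ_{\pi'}\beta\iff\alpha\succ_{\pi\circ\pi'}\beta$.
   Context: Let $V$ be a finite set of variables with finite nonempty domains; outcomes are full assignments to $V$, and $\alpha(U)$ is the restriction of $\alpha$ to $U\subseteq V$. A lex model $\pi$ is a (possibly empty) sequence $(Y_1,\ge_{Y_1}),\ldots,(Y_k,\ge_{Y_k})$ of pairwise distinct variables, each $\ge_{Y_i}$ a total order on the domain of $Y_i$; $V_\pi=\{Y_1,\ldots,Y_k\}$. $\alpha\succ_\pi\beta$ iff there is $i$ with $\alpha(Y_j)=\beta(Y_j)$ for all $j<i$ and $\alpha(Y_i)>_{Y_i}\beta(Y_i)$ strictly; $\alpha\equiv_\pi\beta$ iff $\alpha(V_\pi)=\beta(V_\pi)$; $\alpha\succcurlyeq_\pi\beta$ iff $\alpha\succ_\pi\beta$ or $\alpha\equiv_\pi\beta$. For $\pi'=(Z_1,\ge_{Z_1}),\ldots,(Z_l,\ge_{Z_l})$, $\pi\circ\pi'$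 is the sequence $\pi$ followed by the sequence obtained from $\pi'$ by deleting every pair whose variable lies in $V_\pi$. -}

module Defs where

open import Data.Nat using (ℕ; suc; _<_)
open import Data.Fin using (Fin; toℕ; _≟_)
open import Data.List using (List; map; filter; _++_; length; lookup)
open import Data.List.Membership.Propositional using (_∈_)
import Data.List.Membership.DecPropositional as DecMem
open import Data.List.Relation.Unary.Unique.Propositional using (Unique)
open import Data.Product using (Σ; ∃; _×_)
open import Data.Sum using (_⊎_)
open import Relation.Binary.PropositionalEquality using (_≡_)
open import Relation.Binary.Structures using (IsTotalOrder)
open import Relation.Nullary using (¬_; ¬?)

-- A fixed finite set V of n variables, variable i having the finite
-- nonempty domain Fin (suc (k i)).
module LexModels {n : ℕ} (k : Fin n → ℕ) where

  Var : Set
  Var = Fin n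

  Dom : Var → Set
  Dom Y = Fin (suc (k Y))

  Outcome : Set
  Outcome = (Y : Var) → Dom Y

  record Entry : Set₁ where
    constructor entry
    field
      var  : Var
      ge   : Dom var → Dom var → Set
      isTO : IsTotalOrder _≡_ ge
  open Entry public

  gt : (e : Entry) → Dom (var e) → Dom (var e) → Set
  gt e a b = ge e a b × ¬ (a ≡ b)

  vars : List Entry → List Var
  vars π = map var π

  IsLexModel : List Entry → Set
  IsLexModel π = Unique (vars π)

  _≻[_]_ : Outcome → List Entry → Outcome → Set
  α ≻[ π ] β = Σ (Fin (length π)) λ i →
      (∀ (j : Fin (length π)) → toℕ j < toℕ i →
          α (var (lookup π j)) ≡ β (var (lookup π j)))
    × gt (lookup π i) (α (var (lookup π i))) (β (var (lookup π i)))

  _≡[_]_ : Outcome → List Entry → Outcome → Set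
  α ≡[ π ] β = ∀ (Y : Var) → Y ∈ vars π → α Y ≡ β Y

  _≽[_]_ : Outcome → List Entry → Outcome → Set
  α ≽[ π ] β = (α ≻[ π ] β) ⊎ (α ≡[ π ] β)

  open DecMem (_≟_ {n}) using (_∈?_)

  _∘L_ : List Entry → List Entry → List Entry
  π ∘L π' = π ++ filter (λ e → ¬? (var e ∈? vars π)) π'

{-# OPTIONS --safe #-}
-- A lex model prefers α to β exactly when α and β first differ, along the
-- model, on a variable where α is ranked higher. The pairs that π ∘ π′ drops
-- from π′ carry variables of π; if α ≡_π β, these are variables on which α and
-- β agree, so dropping them changes neither agreement nor the first difference
-- along π′. If instead α ≻_π β, the difference is already found within the
-- prefix π.
module Submission where

open import Defs
open import Data.Nat using (ℕ; z≤n; s≤s)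
open import Data.Fin using (Fin; zero; suc; _≟_)
open import Data.List using (List; _∷_; _++_; filter)
open import Data.List.Relation.Unary.All as All using (All; []; _∷_)
open import Data.List.Relation.Unary.All.Properties
  using (map⁺; map⁻; ++⁺; ++⁻ʳ; all-filter; filter⁺; filter⁻)
open import Data.List.Membership.Propositional using (_∈_)
import Data.List.Membership.DecPropositional as DecMembership
open import Data.Product using (_×_; _,_)
open import Data.Sum using (inj₁; inj₂)
open import Data.Sum.Function.Propositional using (_⊎-⇔_)
open import Function using (_∘_)
open import Function.Bundles using (_⇔_; mk⇔; Equivalence)
open import Level using (0ℓ)
open import Relation.Nullary using (¬?; yes; no; contradiction)
open import Relation.Unary using (Pred; Decidable; _⊆′_)
open import Relation.Binary.PropositionalEquality using (_≡_)

module Comparison {n : ℕ} (k : Fin n → ℕ) where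
  open LexModels k
  open Equivalence using (to; from)

  module _ (α β : Outcome) where

    Agrees : Entry → Set
    Agrees e = α (var e) ≡ β (var e)

    data Prefers : List Entry → Set₁ where
      here  : ∀ {e π} → gt e (α (var e)) (β (var e)) → Prefers (e ∷ π)
      there : ∀ {e π} → Agrees e → Prefers π → Prefers (e ∷ π)

    ≻⇒Prefers : ∀ π → α ≻[ π ] β → Prefers π
    ≻⇒Prefers (e ∷ π) (zero , _ , e≻) = here e≻
    ≻⇒Prefers (e ∷ π) (suc i , agrees , i≻) =
      there (agrees zero (s≤s z≤n))
            (≻⇒Prefers π (i , (λ j j<i → agrees (suc j) (s≤s j<i)) , i≻))

    Prefers⇒≻ : ∀ {π} → Prefers π → α ≻[ π ] β
    Prefers⇒≻ (here e≻) = zero , (λ _ ()) , e≻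
    Prefers⇒≻ (there e-agrees p) with Prefers⇒≻ p
    ... | i , agrees , i≻ =
      suc i , (λ { zero _ → e-agrees ; (suc j) (s≤s j<i) → agrees j j<i }) , i≻

    ≡⇔All : ∀ π → (α ≡[ π ] β) ⇔ All Agrees π
    ≡⇔All π = mk⇔ (λ π≡ → map⁻ (All.tabulate (π≡ _)))
                  (λ agrees _ → All.lookup (map⁺ agrees))

    Prefers-++⁺ˡ : ∀ {π} ρ → Prefers π → Prefers (π ++ ρ)
    Prefers-++⁺ˡ ρ (here e≻) = here e≻
    Prefers-++⁺ˡ ρ (there e-agrees p) = there e-agrees (Prefers-++⁺ˡ ρ p)

    Prefers-++⁺ʳ : ∀ {π ρ} → All Agrees π → Prefers ρ → Prefers (π ++ ρ)
    Prefers-++⁺ʳ [] p = p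
    Prefers-++⁺ʳ (e-agrees ∷ agrees) p = there e-agrees (Prefers-++⁺ʳ agrees p)

    Prefers-++⁻ʳ : ∀ {π ρ} → All Agrees π → Prefers (π ++ ρ) → Prefers ρ
    Prefers-++⁻ʳ [] p = p
    Prefers-++⁻ʳ (e-agrees ∷ _) (here (_ , e≢)) = contradiction e-agrees e≢
    Prefers-++⁻ʳ (_ ∷ agrees) (there _ p) = Prefers-++⁻ʳ agrees p

    module DropAgreeing {ℓ} {Q : Pred Entry ℓ}
                        (Q? : Decidable Q) (Q⊆Agrees : Q ⊆′ Agrees) where

      Prefers-filter⁺ : ∀ π → Prefers π → Prefers (filter (¬? ∘ Q?) π)
      Prefers-filter⁺ (e ∷ π) p with Q? e | p
      ... | yes q | here (_ , e≢)     = contradiction (Q⊆Agrees e q) e≢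
      ... | yes _ | there _ p′        = Prefers-filter⁺ π p′
      ... | no _  | here e≻           = here e≻
      ... | no _  | there e-agrees p′ = there e-agrees (Prefers-filter⁺ π p′)

      Prefers-filter⁻ : ∀ π → Prefers (filter (¬? ∘ Q?) π) → Prefers π
      Prefers-filter⁻ (e ∷ π) p with Q? e | p
      ... | yes q | p′                = there (Q⊆Agrees e q) (Prefers-filter⁻ π p′)
      ... | no _  | here e≻           = here e≻
      ... | no _  | there e-agrees p′ = there e-agrees (Prefers-filter⁻ π p′)

      All-filter⁻ : ∀ π → All Agrees (filter (¬? ∘ Q?) π) → All Agrees π
      All-filter⁻ π = filter⁻ Q? (All.map (Q⊆Agrees _) (all-filter Q? π))

    ≻-∘ˡ : ∀ π π′ → α ≻[ π ] β → α ≻[ π ∘L π′ ] β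
    ≻-∘ˡ π π′ = Prefers⇒≻ ∘ Prefers-++⁺ˡ _ ∘ ≻⇒Prefers π

    module _ (π π′ : List Entry) (π≡ : α ≡[ π ] β) where
      open DecMembership (_≟_ {n}) using (_∈?_)

      private
        π-agrees : All Agrees π
        π-agrees = to (≡⇔All π) π≡

        OnVarsOfπ : Pred Entry 0ℓ
        OnVarsOfπ e = var e ∈ vars π

        onVarsOfπ? : Decidable OnVarsOfπ
        onVarsOfπ? e = var e ∈? vars π

        OnVarsOfπ⊆Agrees : OnVarsOfπ ⊆′ Agrees
        OnVarsOfπ⊆Agrees e = π≡ (var e)

      open DropAgreeing onVarsOfπ? OnVarsOfπ⊆Agrees

      ≻-∘ʳ : (α ≻[ π′ ] β) ⇔ (α ≻[ π ∘L π′ ] β)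
      ≻-∘ʳ = mk⇔
        (Prefers⇒≻ ∘ Prefers-++⁺ʳ π-agrees ∘ Prefers-filter⁺ π′ ∘ ≻⇒Prefers π′)
        (Prefers⇒≻ ∘ Prefers-filter⁻ π′ ∘ Prefers-++⁻ʳ π-agrees ∘ ≻⇒Prefers (π ∘L π′))

      ≡-∘ʳ : (α ≡[ π′ ] β) ⇔ (α ≡[ π ∘L π′ ] β)
      ≡-∘ʳ = mk⇔
        (from (≡⇔All (π ∘L π′)) ∘ ++⁺ π-agrees ∘ filter⁺ _ ∘ to (≡⇔All π′))
        (from (≡⇔All π′) ∘ All-filter⁻ π′ ∘ ++⁻ʳ π ∘ to (≡⇔All (π ∘L π′)))

      ≽-∘ʳ : (α ≽[ π′ ] β) ⇔ (α ≽[ π ∘L π′ ] β)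
      ≽-∘ʳ = ≻-∘ʳ ⊎-⇔ ≡-∘ʳ

    ≻-∘ : ∀ π π′ → α ≽[ π ] β → α ≻[ π′ ] β → α ≻[ π ∘L π′ ] β
    ≻-∘ π π′ (inj₁ π≻) _ = ≻-∘ˡ π π′ π≻
    ≻-∘ π π′ (inj₂ π≡) = to (≻-∘ʳ π π′ π≡)

    ≽-∘ : ∀ π π′ → α ≽[ π ] β → α ≽[ π′ ] β → α ≽[ π ∘L π′ ] β
    ≽-∘ π π′ (inj₁ π≻) _ = inj₁ (≻-∘ˡ π π′ π≻)
    ≽-∘ π π′ (inj₂ π≡) = to (≽-∘ʳ π π′ π≡)

open Comparison

lemma4 : ∀ {n : ℕ} (k : Fin n → ℕ) → let open LexModels k in
    (π π′ : List Entry) → IsLexModel π → IsLexModel π′ → (α β : Outcome) →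
      ((α ≽[ π ] β) → (α ≽[ π′ ] β) → (α ≽[ π ∘L π′ ] β))
    × ((α ≽[ π ] β) → (α ≻[ π′ ] β) → (α ≻[ π ∘L π′ ] β) × (α ≻[ π′ ∘L π ] β))
    × ((α ≡[ π ] β) → ((α ≽[ π′ ] β) ⇔ (α ≽[ π ∘L π′ ] β)) × ((α ≻[ π′ ] β) ⇔ (α ≻[ π ∘L π′ ] β)))
lemma4 k π π′ _ _ α β =
    ≽-∘ k α β π π′
  , (λ π≽ π′≻ → ≻-∘ k α β π π′ π≽ π′≻ , ≻-∘ˡ k α β π′ π π′≻)
  , λ π≡ → ≽-∘ʳ k α β π π′ π≡ , ≻-∘ʳ k α β π π′ π≡
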